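{- Let $P \in \mathsf{Posets}_n$ and let $M = f_{\mathsf{PM}}(P)$ with $\dim(M) = \ell(P)+1$. All the entries on the diagonal of $M$ will be non-zero if and only if $P$ has a chain of length $\ell(P)$.
   Context: $\mathsf{Posets}_n$ is the set of unlabelled (2+2)-free posets on $n$ elements. In such a poset the strict downsets $D(x)=\{y: y\prec x\}$ are linearly ordered by inclusion: $\emptyset=D_0\subsetneq D_1\subsetneq\cdots\subsetneq D_{\ell(P)}$ are the distinct ones; $L_i$ (level $i$) is the set of elements whose strict downset is $D_i$. A chain of length $\ell(P)$ means $\ell(P)+1$ elements $w_1\prec\cdots\prec w_{\ell(P)+1}$. For $j\in[0,\ell(P)]$ let $K_j=D_{j+1}\setminus D_j$, with $D_{\ell(P)+1}:=P$. The map $f_{\mathsf{PM}}$ sends $P$ to the $(\ell(P)+1)\times(\ell(P)+1)$ matrix whose $(i,j)$ entry is $|L_{i-1}\cap K_{j-1}|$; it is a bijection from $\mathsf{Posets}_n$ onto upper-triangular non-negative integer matrices with entries summing to $n$ and no zero rows or columns. -}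

module Defs where

open import Data.Nat using (ℕ; zero; suc; _<_)
open import Data.Fin using (Fin; zero; suc) renaming (_<_ to _<ᶠ_)
open import Data.Fin.Subset using (Subset; ⊤; _∩_; _─_; ∣_∣; _⊂_)
open import Data.Vec.Properties using (≡-dec)
open import Data.Bool.Properties renaming (_≟_ to _≟ᵇ_)
open import Data.Vec using (tabulate)
open import Data.Product using (Σ; ∃; _×_)
open import Relation.Nullary using (¬_; does)
open import Relation.Binary using (Decidable)
open import Relation.Binary.PropositionalEquality using (_≡_)

record Poset (n : ℕ) : Set₁ where
  field
    _≺_     : Fin n → Fin n → Set
    ≺-dec   : Decidable _≺_
    ≺-irrefl : ∀ x → ¬ (x ≺ x)
    ≺-trans : ∀ {x y z} → x ≺ y → y ≺ z → x ≺ z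

module _ {n : ℕ} (P : Poset n) where
  open Poset P

  Incomp : Fin n → Fin n → Set
  Incomp x y = ¬ (x ≡ y) × ¬ (x ≺ y) × ¬ (y ≺ x)

  Has2+2 : Set
  Has2+2 = Σ (Fin n) λ a → Σ (Fin n) λ b → Σ (Fin n) λ c → Σ (Fin n) λ d →
    (a ≺ b) × (c ≺ d) ×
    Incomp a c × Incomp a d × Incomp b c × Incomp b d

  Free2+2 : Set
  Free2+2 = ¬ Has2+2

  down : Fin n → Subset n
  down x = tabulate λ y → does (≺-dec y x)

  -- D : Fin (ℓ+1) → Subset n enumerates the distinct strict downsets
  -- D_0 ⊊ D_1 ⊊ ... ⊊ D_ℓ (strictly increasing, each D_i is some D(x),
  -- every D(x) is some D_i).  Then ℓ = ℓ(P).
  IsDownsetChain : (ℓ : ℕ) → (Fin (suc ℓ) → Subset n) → Set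
  IsDownsetChain ℓ D =
    (∀ i j → i <ᶠ j → D i ⊂ D j) ×
    (∀ i → ∃ λ x → down x ≡ D i) ×
    (∀ x → ∃ λ i → down x ≡ D i)

  -- chain of length ℓ : ℓ+1 elements w_1 ≺ ... ≺ w_{ℓ+1}
  HasChainOfLength : ℕ → Set
  HasChainOfLength ℓ = Σ (Fin (suc ℓ) → Fin n) λ w → ∀ i j → i <ᶠ j → w i ≺ w j

-- D_{j+1}, with the convention D_{ℓ+1} := P (the full set)
nextD : ∀ {n ℓ} → (Fin (suc ℓ) → Subset n) → Fin (suc ℓ) → Subset n
nextD {ℓ = zero}  D zero    = ⊤
nextD {ℓ = suc ℓ} D zero    = D (suc zero)
nextD {ℓ = suc ℓ} D (suc i) = nextD (λ k → D (suc k)) i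

module _ {n : ℕ} (P : Poset n) where
  levelSet : ∀ {ℓ} → (Fin (suc ℓ) → Subset n) → Fin (suc ℓ) → Subset n
  levelSet D i = tabulate λ x → does (≡-dec _≟ᵇ_ (down P x) (D i))

  KSet : ∀ {ℓ} → (Fin (suc ℓ) → Subset n) → Fin (suc ℓ) → Subset n
  KSet D j = nextD D j ─ D j

  -- the matrix f_PM(P), 0-indexed: entry (i,j) = |L_i ∩ K_j|
  fPM : ∀ {ℓ} → (Fin (suc ℓ) → Subset n) → Fin (suc ℓ) → Fin (suc ℓ) → ℕ
  fPM D i j = ∣ levelSet D i ∩ KSet D j ∣

-- The diagonal entry (i,i) counts the elements of level L_i lying in D_{i+1}.  If every
-- diagonal entry is non-zero, pick x_i in each of those sets: then x_i ∈ D_{i+1} = D(x_{i+1}),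
-- so x_0 ≺ x_1 ≺ ⋯ ≺ x_ℓ.  Conversely, along a chain w_0 ≺ ⋯ ≺ w_ℓ the levels of the w_i
-- strictly increase, and a strictly increasing self-map of {0,…,ℓ} is the identity; so w_i
-- has level i and lies in D(w_{i+1}) = D_{i+1}, and w_ℓ lies in D_{ℓ+1} = P.
module Submission where

open import Defs
open import Data.Bool.Properties using () renaming (_≟_ to _≟ᵇ_)
open import Data.Fin using (Fin; zero; suc; toℕ; inject₁; fromℕ; opposite)
  renaming (_<_ to _<ᶠ_; _≤_ to _≤ᶠ_)
open import Data.Fin.Properties
  using (toℕ-inject₁; toℕ<n; toℕ-injective; ≤̄⇒inject₁<; opposite-prop; opposite-involutive; <-cmp)
open import Data.Fin.Relation.Unary.Top using (view; ‵fromℕ; ‵inject₁)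
open import Data.Fin.Subset using (Subset; _∈_; _∉_; ∣_∣; ⊤; inside; outside; Nonempty)
open import Data.Fin.Subset.Properties using (x∈p∩q⁺; x∈p∩q⁻; ∈⊤; x∈p∧x∉q⇒x∈p─q; p─q⊆p)
open import Data.Nat using (ℕ; zero; suc; _<_; z≤n; s≤s)
import Data.Nat.Properties as ℕ
open import Data.Product using (∃; _×_; _,_; proj₁; proj₂)
open import Data.Vec using (_∷_; tabulate; here; there)
open import Data.Vec.Properties using (lookup∘tabulate; []=⇒lookup; lookup⇒[]=; ≡-dec)
open import Function using (_∘_)
open import Function.Bundles using (_⇔_; mk⇔; Equivalence)
open import Relation.Binary using (Rel; Transitive; _Preserves_⟶_; tri<; tri≈; tri>)
open import Relation.Binary.PropositionalEquality using (_≡_; refl; sym; trans; cong; subst; subst₂)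
open import Relation.Nullary using (does; yes; no; contradiction)
open import Relation.Nullary.Decidable using (dec-true)
open import Relation.Unary using (Pred; Decidable)

module _ {n p} {P : Pred (Fin n) p} (P? : Decidable P) where

  ∈-tabulate⁺ : ∀ {x} → P x → x ∈ tabulate (does ∘ P?)
  ∈-tabulate⁺ {x} px = lookup⇒[]= x _ (trans (lookup∘tabulate _ x) (dec-true (P? x) px))

  ∈-tabulate⁻ : ∀ {x} → x ∈ tabulate (does ∘ P?) → P x
  ∈-tabulate⁻ {x} x∈ with P? x | trans (sym (lookup∘tabulate (does ∘ P?) x)) ([]=⇒lookup x∈)
  ... | yes px | _  = px
  ... | no  _  | ()

x∈p⇒0<∣p∣ : ∀ {n} {p : Subset n} {x} → x ∈ p → 0 < ∣ p ∣
x∈p⇒0<∣p∣ {p = inside  ∷ p} here      = s≤s z≤n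
x∈p⇒0<∣p∣ {p = inside  ∷ p} (there _) = s≤s z≤n
x∈p⇒0<∣p∣ {p = outside ∷ p} (there x∈p) = x∈p⇒0<∣p∣ x∈p

0<∣p∣⇒nonempty : ∀ {n} (p : Subset n) → 0 < ∣ p ∣ → Nonempty p
0<∣p∣⇒nonempty (inside  ∷ p) _ = zero , here
0<∣p∣⇒nonempty (outside ∷ p) 0<∣p∣ with 0<∣p∣⇒nonempty p 0<∣p∣
... | x , x∈p = suc x , there x∈p

inject₁-mono-< : ∀ {m} {i j : Fin m} → i <ᶠ j → inject₁ i <ᶠ inject₁ j
inject₁-mono-< {i = i} {j} = subst₂ _<_ (sym (toℕ-inject₁ i)) (sym (toℕ-inject₁ j))

opposite-anti-< : ∀ {m} {i j : Fin m} → i <ᶠ j → opposite j <ᶠ opposite i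
opposite-anti-< {m} {i} {j} i<j =
  subst₂ _<_ (sym (opposite-prop j)) (sym (opposite-prop i)) (ℕ.∸-monoʳ-< (s≤s i<j) (toℕ<n j))

strictMono⇒≤ : ∀ {m k} (f : Fin m → Fin k) → f Preserves _<ᶠ_ ⟶ _<ᶠ_ → ∀ i → i ≤ᶠ f i
strictMono⇒≤ f mono zero = z≤n
strictMono⇒≤ {suc m} f mono (suc i) =
  ℕ.≤-<-trans (strictMono⇒≤ (f ∘ inject₁) (mono ∘ inject₁-mono-<) i) (mono (≤̄⇒inject₁< ℕ.≤-refl))

-- The upper bound is the lower bound for the conjugate of f by the order-reversing `opposite`.
strictMono⇒≡id : ∀ {m} (f : Fin m → Fin m) → f Preserves _<ᶠ_ ⟶ _<ᶠ_ → ∀ i → f i ≡ i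
strictMono⇒≡id {m} f mono i = toℕ-injective (ℕ.≤-antisym f≤i (strictMono⇒≤ f mono i))
  where
  f′ : Fin m → Fin m
  f′ = opposite ∘ f ∘ opposite

  f′-mono : f′ Preserves _<ᶠ_ ⟶ _<ᶠ_
  f′-mono = opposite-anti-< ∘ mono ∘ opposite-anti-<

  f≤i : f i ≤ᶠ i
  f≤i = ℕ.≮⇒≥ λ i<fi →
    ℕ.<⇒≱ (opposite-anti-< i<fi)
      (subst (λ y → opposite i ≤ᶠ opposite (f y)) (opposite-involutive i)
        (strictMono⇒≤ f′ f′-mono (opposite i)))

module _ {a r} {A : Set a} {R : Rel A r} (R-trans : Transitive R) where

  successor-steps⇒increasing : ∀ {ℓ} (w : Fin (suc ℓ) → A) →
    (∀ j → R (w (inject₁ j)) (w (suc j))) → w Preserves _<ᶠ_ ⟶ R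
  successor-steps⇒increasing {suc ℓ} w step {zero} {suc zero} _ = step zero
  successor-steps⇒increasing {suc ℓ} w step {zero} {suc (suc j)} _ =
    R-trans (step zero) (successor-steps⇒increasing (w ∘ suc) (step ∘ suc) {zero} {suc j} (s≤s z≤n))
  successor-steps⇒increasing {suc ℓ} w step {suc i} {suc j} (s≤s i<j) =
    successor-steps⇒increasing (w ∘ suc) (step ∘ suc) i<j

nextD-inject₁ : ∀ {n ℓ} (D : Fin (suc ℓ) → Subset n) (j : Fin ℓ) → nextD D (inject₁ j) ≡ D (suc j)
nextD-inject₁ {ℓ = suc ℓ} D zero    = refl
nextD-inject₁ {ℓ = suc ℓ} D (suc j) = nextD-inject₁ (D ∘ suc) j

nextD-fromℕ : ∀ {n ℓ} (D : Fin (suc ℓ) → Subset n) → nextD D (fromℕ ℓ) ≡ ⊤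
nextD-fromℕ {ℓ = zero}  D = refl
nextD-fromℕ {ℓ = suc ℓ} D = nextD-fromℕ (D ∘ suc)

module _ {n : ℕ} (P : Poset n) where
  open Poset P

  ∈-down⁺ : ∀ {x y} → y ≺ x → y ∈ down P x
  ∈-down⁺ {x} = ∈-tabulate⁺ (λ y → ≺-dec y x)

  ∈-down⁻ : ∀ {x y} → y ∈ down P x → y ≺ x
  ∈-down⁻ {x} = ∈-tabulate⁻ (λ y → ≺-dec y x)

  ∉-down-self : ∀ {x} → x ∉ down P x
  ∉-down-self {x} = ≺-irrefl x ∘ ∈-down⁻

  module _ {ℓ : ℕ} (D : Fin (suc ℓ) → Subset n) where

    DiagonalCell : Fin (suc ℓ) → Fin n → Set
    DiagonalCell i x = down P x ≡ D i × x ∈ nextD D i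

    0<fPM-diagonal⇔ : ∀ i → 0 < fPM P D i i ⇔ ∃ (DiagonalCell i)
    0<fPM-diagonal⇔ i = mk⇔ witness count
      where
      level? : Decidable (λ x → down P x ≡ D i)
      level? = λ x → ≡-dec _≟ᵇ_ (down P x) (D i)

      witness : 0 < fPM P D i i → ∃ (DiagonalCell i)
      witness 0<entry with 0<∣p∣⇒nonempty _ 0<entry
      ... | x , x∈L∩K with x∈p∩q⁻ (levelSet P D i) (KSet P D i) x∈L∩K
      ... | x∈L , x∈K = x , ∈-tabulate⁻ level? x∈L , p─q⊆p (nextD D i) (D i) x∈K

      count : ∃ (DiagonalCell i) → 0 < fPM P D i i
      count (x , Dx≡Di , x∈next) = x∈p⇒0<∣p∣ (x∈p∩q⁺ (∈-tabulate⁺ level? Dx≡Di ,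
        x∈p∧x∉q⇒x∈p─q x∈next (∉-down-self ∘ subst (x ∈_) (sym Dx≡Di))))

    diagonal-witnesses⇒chain : (∀ i → ∃ (DiagonalCell i)) →
      HasChainOfLength P ℓ
    diagonal-witnesses⇒chain witness =
      w , λ i j → successor-steps⇒increasing {R = _≺_} ≺-trans w step {i} {j}
      where
      w : Fin (suc ℓ) → Fin n
      w = proj₁ ∘ witness

      step : ∀ j → w (inject₁ j) ≺ w (suc j)
      step j with witness (inject₁ j) | witness (suc j)
      ... | x , _ , x∈next | y , Dy≡Dj+1 , _ =
        ∈-down⁻ (subst (x ∈_) (trans (nextD-inject₁ D j) (sym Dy≡Dj+1)) x∈next)

    module _ (isChain : IsDownsetChain P ℓ D) where
      ≺⇒level< : ∀ {x y a b} → down P x ≡ D a → down P y ≡ D b → x ≺ y → a <ᶠ b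
      ≺⇒level< {x} {y} {a} {b} Dx≡Da Dy≡Db x≺y with <-cmp a b
      ... | tri< a<b _ _ = a<b
      ... | tri≈ _ refl _ =
        contradiction (subst (x ∈_) (trans Dy≡Db (sym Dx≡Da)) (∈-down⁺ x≺y)) ∉-down-self
      ... | tri> _ _ b<a = contradiction
        (subst (x ∈_) (sym Dx≡Da) (proj₁ (proj₁ isChain b a b<a) (subst (x ∈_) Dy≡Db (∈-down⁺ x≺y))))
        ∉-down-self

      chain⇒diagonal-witnesses : HasChainOfLength P ℓ →
        ∀ i → ∃ (DiagonalCell i)
      chain⇒diagonal-witnesses (w , w-mono) i = w i , w-level i , w∈next i
        where
        level : Fin n → Fin (suc ℓ)
        level x = proj₁ (proj₂ (proj₂ isChain) x)

        down≡D-level : ∀ x → down P x ≡ D (level x)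
        down≡D-level x = proj₂ (proj₂ (proj₂ isChain) x)

        level∘w≡id : ∀ i → level (w i) ≡ i
        level∘w≡id = strictMono⇒≡id (level ∘ w)
          λ {i} {j} i<j → ≺⇒level< (down≡D-level (w i)) (down≡D-level (w j)) (w-mono i j i<j)

        w-level : ∀ i → down P (w i) ≡ D i
        w-level i = trans (down≡D-level (w i)) (cong D (level∘w≡id i))

        w∈next : ∀ i → w i ∈ nextD D i
        w∈next i with view i
        ... | ‵fromℕ = subst (w _ ∈_) (sym (nextD-fromℕ D)) ∈⊤
        ... | ‵inject₁ j = subst (w (inject₁ j) ∈_) (trans (w-level (suc j)) (sym (nextD-inject₁ D j)))
          (∈-down⁺ (w-mono _ _ (≤̄⇒inject₁< ℕ.≤-refl)))

proposition3p7 : (n : ℕ) (P : Poset n) → Free2+2 P →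
    (ℓ : ℕ) (D : Fin (suc ℓ) → Subset n) → IsDownsetChain P ℓ D →
    ((∀ i → 0 < fPM P D i i) ⇔ HasChainOfLength P ℓ)
proposition3p7 n P _ ℓ D isChain = mk⇔
  (λ diagonal>0 → diagonal-witnesses⇒chain P D λ i → Equivalence.to (0<fPM-diagonal⇔ P D i) (diagonal>0 i))
  (λ chain i → Equivalence.from (0<fPM-diagonal⇔ P D i) (chain⇒diagonal-witnesses P D isChain chain i))
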